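{- Let $G$ be a strong bicentral $2$-tree on $n\ge 4$ vertices with tail set $\{2,3\}$ and maximum degree $\Delta$, and let $x$ be the number of tail vertices of degree $3$. Then the following are equivalent: (i) $x=0$; (ii) $\Delta=n-1$; (iii) $G\cong B_{n-2}$. Consequently, the triangular book graph $B_{n-2}$ is the unique strong bicentral $2$-tree with degree sequence $(n-1,n-1,2^{(n-2)})$.
   Context: A $2$-tree is a graph obtained from the triangle $K_3$ by repeatedly adding a new vertex adjacent to both endpoints of an existing edge. For $r\in\{1,2,3\}$ and an integer $\Delta\ge 2$, a $2$-tree on $n$ vertices is $r$-central with maximum degree $\Delta$ if $\Delta$ is its maximum degree and exactly $r$ vertices have degree $\Delta$; these $r$ vertices form the core and the other $n-r$ vertices form the tail. It is strong if the core induces $K_r$. It has tail set $\{2,3\}$ if every tail vertex has degree $2$ or $3$. "Bicentral" means $2$-central. The triangular book graph $B_k$ consists of an edge $ab$ together with $k$ further vertices, each adjacent exactly to $a$ and $b$. The notation $2^{(k)}$ means $k$ entries equal to $2$. -}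

module Defs where

open import Data.Nat using (ℕ; zero; suc; _+_; _≤_; _<_; _∸_)
open import Data.Bool using (Bool; true; false; _∨_; if_then_else_)
open import Data.Fin using (Fin; zero; suc; toℕ; _≟_)
open import Data.Fin.Permutation using (Permutation′; _⟨$⟩ʳ_)
open import Data.List using (List; map; allFin)
open import Data.Nat.ListAction using (sum)
open import Data.Product using (Σ; _×_; _,_; ∃)
open import Data.Sum using (_⊎_)
open import Relation.Nullary using (¬_; Dec; yes; no; does)
open import Relation.Binary.PropositionalEquality using (_≡_; _≢_)
open import Data.Nat using () renaming (_≟_ to _≟ℕ_; _<?_ to _<?ℕ_)

record Graph (n : ℕ) : Set where
  field
    adj    : Fin n → Fin n → Bool
    sym    : ∀ i j → adj i j ≡ adj j i
    irrefl : ∀ i → adj i i ≡ false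
open Graph public

Adj : ∀ {n} → Graph n → Fin n → Fin n → Set
Adj G i j = adj G i j ≡ true

count : ∀ {n} → (Fin n → Bool) → ℕ
count {n} p = sum (map (λ i → if p i then 1 else 0) (allFin n))

deg : ∀ {n} → Graph n → Fin n → ℕ
deg G v = count (adj G v)

_≅_ : ∀ {n} → Graph n → Graph n → Set
_≅_ {n} G H = Σ (Permutation′ n) λ σ → ∀ i j → adj G i j ≡ adj H (σ ⟨$⟩ʳ i) (σ ⟨$⟩ʳ j)

K3 : Graph 3
K3 = record { adj = λ i j → if does (i ≟ j) then false else true
            ; sym = symK ; irrefl = irrK }
  where
  symK : ∀ (i j : Fin 3) → (if does (i ≟ j) then false else true) ≡ (if does (j ≟ i) then false else true)
  symK zero zero = _≡_.refl
  symK zero (suc zero) = _≡_.refl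
  symK zero (suc (suc zero)) = _≡_.refl
  symK (suc zero) zero = _≡_.refl
  symK (suc zero) (suc zero) = _≡_.refl
  symK (suc zero) (suc (suc zero)) = _≡_.refl
  symK (suc (suc zero)) zero = _≡_.refl
  symK (suc (suc zero)) (suc zero) = _≡_.refl
  symK (suc (suc zero)) (suc (suc zero)) = _≡_.refl
  irrK : ∀ (i : Fin 3) → (if does (i ≟ i) then false else true) ≡ false
  irrK zero = _≡_.refl
  irrK (suc zero) = _≡_.refl
  irrK (suc (suc zero)) = _≡_.refl

extendAdj : ∀ {n} → Graph n → Fin n → Fin n → Fin (suc n) → Fin (suc n) → Bool
extendAdj G a b zero    zero    = false
extendAdj G a b zero    (suc j) = does (j ≟ a) ∨ does (j ≟ b)
extendAdj G a b (suc i) zero    = does (i ≟ a) ∨ does (i ≟ b)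
extendAdj G a b (suc i) (suc j) = adj G i j

extend : ∀ {n} → Graph n → Fin n → Fin n → Graph (suc n)
extend G a b = record { adj = extendAdj G a b ; sym = s ; irrefl = ir }
  where
  s : ∀ i j → extendAdj G a b i j ≡ extendAdj G a b j i
  s zero zero = _≡_.refl
  s zero (suc j) = _≡_.refl
  s (suc i) zero = _≡_.refl
  s (suc i) (suc j) = Graph.sym G i j
  ir : ∀ i → extendAdj G a b i i ≡ false
  ir zero = _≡_.refl
  ir (suc i) = Graph.irrefl G i

data Built2Tree : (n : ℕ) → Graph n → Set where
  base : Built2Tree 3 K3
  add  : ∀ {n} {G : Graph n} → Built2Tree n G →
         (a b : Fin n) → Adj G a b → Built2Tree (suc n) (extend G a b)

Is2Tree : ∀ {n} → Graph n → Set
Is2Tree {n} G = ∃ λ H → Built2Tree n H × (G ≅ H)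

IsMaxDegree : ∀ {n} → Graph n → ℕ → Set
IsMaxDegree G Δ = (∀ v → deg G v ≤ Δ) × (∃ λ v → deg G v ≡ Δ)

inCore : ∀ {n} → Graph n → ℕ → Fin n → Bool
inCore G Δ v = does (deg G v ≟ℕ Δ)

IsCentral : ∀ {n} → ℕ → Graph n → ℕ → Set
IsCentral r G Δ = IsMaxDegree G Δ × count (inCore G Δ) ≡ r

IsStrong : ∀ {n} → Graph n → ℕ → Set
IsStrong G Δ = ∀ u v → deg G u ≡ Δ → deg G v ≡ Δ → u ≢ v → Adj G u v

IsStrongBicentral : ∀ {n} → Graph n → ℕ → Set
IsStrongBicentral G Δ = IsCentral 2 G Δ × IsStrong G Δ

TailSet23 : ∀ {n} → Graph n → ℕ → Set
TailSet23 G Δ = ∀ v → deg G v ≢ Δ → (deg G v ≡ 2 ⊎ deg G v ≡ 3)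

tailDeg3Count : ∀ {n} → Graph n → ℕ → ℕ
tailDeg3Count G Δ = count (λ v → if inCore G Δ v then false else does (deg G v ≟ℕ 3))

-- Triangular book graph B_{n-2} on Fin n: vertices 0 and 1 form the spine
-- edge ab, every other vertex is adjacent exactly to 0 and 1.

bookAdj : ∀ n → Fin n → Fin n → Bool
bookAdj n i j = if does (i ≟ j) then false
                else (does (toℕ i <?ℕ 2) ∨ does (toℕ j <?ℕ 2))

Book : ∀ n → Graph n
Book n = record { adj = bookAdj n ; sym = s ; irrefl = ir }
  where
  open import Data.Bool.Properties using (∨-comm)
  open import Relation.Binary.PropositionalEquality using (refl; cong)
  open import Relation.Nullary using (_because_)
  s : ∀ i j → bookAdj n i j ≡ bookAdj n j i
  s i j with i ≟ j | j ≟ i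
  ... | yes _ | yes _ = refl
  ... | yes p | no q = Data.Empty.⊥-elim (q (Relation.Binary.PropositionalEquality.sym p))
    where import Data.Empty
  ... | no p | yes q = Data.Empty.⊥-elim (p (Relation.Binary.PropositionalEquality.sym q))
    where import Data.Empty
  ... | no _ | no _ = ∨-comm (does (toℕ i <?ℕ 2)) (does (toℕ j <?ℕ 2))
  ir : ∀ i → bookAdj n i i ≡ false
  ir i with i ≟ i
  ... | yes _ = refl
  ... | no p = Data.Empty.⊥-elim (p refl)
    where import Data.Empty

{-# OPTIONS --safe #-}
module Submission where

-- A 2-tree on n vertices has 2n − 3 edges, so its degrees sum to 4n − 6. In a
-- bicentral 2-tree whose tail degrees are 2 and 3 the same sum is
-- 2Δ + 2(n − 2) + x, hence 2(Δ + 1) + x = 2n, and x = 0 exactly when Δ = n − 1.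
-- If Δ = n − 1 the two core vertices are adjacent to everything, and every other
-- vertex has degree 2, so its neighbours are exactly the two core vertices: this
-- is the book B_{n−2} with the core as spine. Conversely B_{n−2} has a vertex of
-- degree n − 1.

open import Defs hiding (sym)
open import Data.Bool as Bool using (Bool; true; false; _∨_; _∧_; not; if_then_else_)
open import Data.Bool.Properties using (⇔→≡; ∨-identityʳ; ∨-inverseʳ; ∧-inverseʳ)
open import Data.Empty using (⊥-elim)
open import Data.Fin using (Fin; zero; suc; toℕ; _≟_; fromℕ; inject₁)
open import Data.Fin.Permutation
  using (Permutation′; _⟨$⟩ʳ_; _⟨$⟩ˡ_; inverseˡ; inverseʳ; transpose; _∘ₚ_)
open import Data.Fin.Properties using (any?; all?; fromℕ≢inject₁)
import Data.List as List
import Data.Nat.ListAction as ListAction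
open import Data.List.Properties using (map-tabulate)
open import Data.Nat as ℕ using (ℕ; zero; suc; _+_; _*_; _∸_; _≤_; _<_; z≤n; s≤s)
  renaming (_≟_ to _≟ℕ_)
open import Data.Nat.Properties
  using (+-*-semiring; ≤-refl; ≤-reflexive; ≤-trans; ≤-antisym; <⇒≱; <-irrefl; +-mono-≤;
         +-mono-≤-<; +-identityʳ; *-identityˡ; *-suc; +-assoc; +-cancelˡ-≡; +-cancelʳ-≡;
         *-cancelˡ-≡; suc-injective)
open import Algebra.Properties.Semiring.Sum +-*-semiring
  using (sum-syntax; sum-cong-≗; ∑-distrib-+; ∑-permute; *-distribʳ-sum)
open import Data.Nat.Tactic.RingSolver using (solve-∀)
open import Data.Product using (_×_; _,_; proj₁; proj₂; ∃-syntax)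
open import Data.Sum using (_⊎_; inj₁; inj₂)
open import Function using (_∘_; id)
open import Function.Bundles using (_⇔_; mk⇔; Equivalence)
open import Relation.Binary.PropositionalEquality
open import Relation.Nullary using (Dec; yes; no; does; ¬_)
open import Relation.Nullary.Decidable using (dec-true; dec-false; does-⇔; from-yes; _×-dec_)

private
  variable
    n : ℕ
    p q : Fin n → Bool
    u v i j : Fin n

does-true : ∀ {A : Set} (a? : Dec A) → does a? ≡ true → A
does-true (yes a) _ = a
does-true (no _) ()

does-false : ∀ {A : Set} (a? : Dec A) → does a? ≡ false → ¬ A
does-false (yes _) ()
does-false (no ¬a) _ = ¬a

-- Counting Boolean predicates on Fin n

indicator : Bool → ℕ
indicator b = if b then 1 else 0

sum-tabulate : (f : Fin n → ℕ) → ListAction.sum (List.tabulate f) ≡ ∑[ k < n ] f k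
sum-tabulate {zero}  f = refl
sum-tabulate {suc n} f = cong (f zero +_) (sum-tabulate (f ∘ suc))

count-∑ : (p : Fin n → Bool) → count p ≡ ∑[ k < n ] indicator (p k)
count-∑ {n} p =
  trans (cong ListAction.sum (map-tabulate {n = n} id (indicator ∘ p))) (sum-tabulate (indicator ∘ p))

count-suc : (p : Fin (suc n) → Bool) → count p ≡ indicator (p zero) + count (p ∘ suc)
count-suc p = trans (count-∑ p) (cong (indicator (p zero) +_) (sym (count-∑ (p ∘ suc))))

count-cong : p ≗ q → count p ≡ count q
count-cong {p = p} {q} p≗q =
  trans (count-∑ p) (trans (sum-cong-≗ (cong indicator ∘ p≗q)) (sym (count-∑ q)))

count-permute : (σ : Permutation′ n) → count (p ∘ (σ ⟨$⟩ʳ_)) ≡ count p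
count-permute {p = p} σ =
  trans (count-∑ (p ∘ (σ ⟨$⟩ʳ_))) (trans (sym (∑-permute (indicator ∘ p) σ)) (sym (count-∑ p)))

count-false : count {n} (λ _ → false) ≡ 0
count-false {zero}  = refl
count-false {suc n} = trans (count-suc {n} (λ _ → false)) (count-false {n})

count-true : count {n} (λ _ → true) ≡ n
count-true {zero}  = refl
count-true {suc n} = trans (count-suc {n} (λ _ → true)) (cong suc (count-true {n}))

count-∨ : (∀ k → p k ∧ q k ≡ false) → count (λ k → p k ∨ q k) ≡ count p + count q
count-∨ {p = p} {q} disjoint =
  trans (count-∑ (λ k → p k ∨ q k)) (trans (sum-cong-≗ split)
    (trans (∑-distrib-+ (indicator ∘ p) (indicator ∘ q))
      (sym (cong₂ _+_ (count-∑ p) (count-∑ q)))))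
  where
  split : ∀ k → indicator (p k ∨ q k) ≡ indicator (p k) + indicator (q k)
  split k with p k | q k | disjoint k
  ... | true  | false | _ = refl
  ... | false | _     | _ = refl

count-complement : (p : Fin n → Bool) → count p + count (not ∘ p) ≡ n
count-complement p =
  trans (sym (count-∨ (∧-inverseʳ ∘ p))) (trans (count-cong (∨-inverseʳ ∘ p)) count-true)

∑-if : (p : Fin n → Bool) (a b : ℕ) →
       ∑[ k < n ] (if p k then a else b) ≡ count p * a + count (not ∘ p) * b
∑-if {n} p a b = begin
  ∑[ k < n ] (if p k then a else b)
    ≡⟨ sum-cong-≗ split ⟩
  ∑[ k < n ] (indicator (p k) * a + indicator (not (p k)) * b)
    ≡⟨ ∑-distrib-+ (λ k → indicator (p k) * a) (λ k → indicator (not (p k)) * b) ⟩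
  ∑[ k < n ] (indicator (p k) * a) + ∑[ k < n ] (indicator (not (p k)) * b)
    ≡⟨ cong₂ _+_ (*-distribʳ-sum a (indicator ∘ p)) (*-distribʳ-sum b (indicator ∘ not ∘ p)) ⟨
  ∑[ k < n ] indicator (p k) * a + ∑[ k < n ] indicator (not (p k)) * b
    ≡⟨ sym (cong₂ (λ s t → s * a + t * b) (count-∑ p) (count-∑ (not ∘ p))) ⟩
  count p * a + count (not ∘ p) * b ∎
  where
  open ≡-Reasoning
  split : ∀ k → (if p k then a else b) ≡ indicator (p k) * a + indicator (not (p k)) * b
  split k with p k
  ... | true  = sym (trans (+-identityʳ (1 * a)) (*-identityˡ a))
  ... | false = sym (*-identityˡ b)

_⊆_ : (p q : Fin n → Bool) → Set
p ⊆ q = ∀ k → p k ≡ true → q k ≡ true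

⊆-antisym : p ⊆ q → q ⊆ p → p ≗ q
⊆-antisym p⊆q q⊆p k = ⇔→≡ (mk⇔ (p⊆q k) (q⊆p k))

indicator-mono : ∀ {a b} → (a ≡ true → b ≡ true) → indicator a ≤ indicator b
indicator-mono {false} _   = z≤n
indicator-mono {true}  a⇒b rewrite a⇒b refl = ≤-refl

count-mono : p ⊆ q → count p ≤ count q
count-mono {zero}          _   = z≤n
count-mono {suc n} {p} {q} p⊆q rewrite count-suc p | count-suc q =
  +-mono-≤ (indicator-mono (p⊆q zero)) (count-mono (p⊆q ∘ suc))

count-mono-< : p ⊆ q → q j ≡ true → p j ≡ false → count p < count q
count-mono-< {p = p} {q} {zero} p⊆q qj pj rewrite count-suc p | count-suc q | qj | pj =
  s≤s (count-mono (p⊆q ∘ suc))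
count-mono-< {p = p} {q} {suc j} p⊆q qj pj rewrite count-suc p | count-suc q =
  +-mono-≤-< (indicator-mono (p⊆q zero)) (count-mono-< (p⊆q ∘ suc) qj pj)

count-≤⇒⊇ : p ⊆ q → count q ≤ count p → q ⊆ p
count-≤⇒⊇ {p = p} p⊆q q≤p k qk with p k in pk
... | true  = refl
... | false = ⊥-elim (<⇒≱ (count-mono-< p⊆q qk pk) q≤p)

count≡0⇒false : count p ≡ 0 → ∀ k → p k ≡ false
count≡0⇒false {n} {p} c k with p k in pk
... | false = refl
... | true  = ⊥-elim (<-irrefl (sym c) 0<count)
  where
  0<count : 0 < count p
  0<count = subst (_< count p) (count-false {n}) (count-mono-< {p = λ _ → false} {q = p} (λ _ ()) pk refl)

count-witness : count q < count p → ∃[ k ] p k ≡ true × q k ≡ false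
count-witness {q = q} {p = p} q<p with any? (λ k → (p k Bool.≟ true) ×-dec (q k Bool.≟ false))
... | yes found = found
... | no none   = ⊥-elim (<⇒≱ q<p (count-mono p⊆q))
  where
  p⊆q : p ⊆ q
  p⊆q k pk with q k in qk
  ... | true  = refl
  ... | false = ⊥-elim (none (k , pk , qk))

single : Fin n → Fin n → Bool
single u k = does (k ≟ u)

others : Fin n → Fin n → Bool
others u = not ∘ single u

spine : Fin n → Fin n → Fin n → Bool
spine u v k = single u k ∨ single v k

spine-left : (u v : Fin n) → spine u v u ≡ true
spine-left u v = cong (_∨ single v u) (dec-true (u ≟ u) refl)

count-single : (u : Fin n) → count (single u) ≡ 1
count-single {suc n} zero    = trans (count-suc {n} (single zero)) (cong suc (count-false {n}))
count-single {suc n} (suc u) = trans (count-suc {n} (single (suc u))) (count-single u)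

count-others : (u : Fin n) → count (others u) ≡ n ∸ 1
count-others u =
  cong (_∸ 1) (trans (cong (_+ count (others u)) (sym (count-single u))) (count-complement (single u)))

count-spine : u ≢ v → count (spine u v) ≡ 2
count-spine {u = u} {v} u≢v = trans (count-∨ disjoint) (cong₂ _+_ (count-single u) (count-single v))
  where
  disjoint : ∀ k → single u k ∧ single v k ≡ false
  disjoint k with k ≟ u | k ≟ v
  ... | yes refl | yes refl = ⊥-elim (u≢v refl)
  ... | yes _    | no _     = refl
  ... | no _     | _        = refl

count≡2⇒spine : count p ≡ 2 → ∃[ u ] ∃[ v ] u ≢ v × p ≗ spine u v
count≡2⇒spine {n} {p} c
  with u , pu , _   ← count-witness {q = λ _ → false} (subst₂ _<_ (sym (count-false {n})) (sym c) (s≤s z≤n))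
  with v , pv , v≠u ← count-witness {q = single u} (subst₂ _<_ (sym (count-single u)) (sym c) ≤-refl)
  = u , v , u≢v ,
    ⊆-antisym (count-≤⇒⊇ spine⊆p (≤-reflexive (trans c (sym (count-spine u≢v))))) spine⊆p
  where
  u≢v : u ≢ v
  u≢v u≡v = does-false (v ≟ u) v≠u (sym u≡v)
  spine⊆p : spine u v ⊆ p
  spine⊆p k _  with k ≟ u | k ≟ v
  spine⊆p k _  | yes refl | _        = pu
  spine⊆p k _  | no _     | yes refl = pv
  spine⊆p k () | no _     | no _

Adj-sym : (G : Graph n) → Adj G i j → Adj G j i
Adj-sym {i = i} {j} G ij = trans (Graph.sym G j i) ij

Adj⇒≢ : (G : Graph n) → Adj G i j → i ≢ j
Adj⇒≢ {i = i} G ij refl with () ← trans (sym ij) (irrefl G i)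

adj⊆others : (G : Graph n) (u : Fin n) → adj G u ⊆ others u
adj⊆others G u k uk with k ≟ u
... | yes refl with () ← trans (sym uk) (irrefl G u)
... | no _ = refl

deg≤n∸1 : (G : Graph n) (u : Fin n) → deg G u ≤ n ∸ 1
deg≤n∸1 G u = ≤-trans (count-mono (adj⊆others G u)) (≤-reflexive (count-others u))

deg≡n∸1⇒adj≗others : (G : Graph n) → deg G u ≡ n ∸ 1 → adj G u ≗ others u
deg≡n∸1⇒adj≗others {u = u} G d =
  ⊆-antisym (adj⊆others G u)
    (count-≤⇒⊇ (adj⊆others G u) (≤-reflexive (trans (count-others u) (sym d))))

isStrong-n∸1 : (G : Graph n) → IsStrong G (n ∸ 1)
isStrong-n∸1 G u v du _ u≢v =
  trans (deg≡n∸1⇒adj≗others G du v) (cong not (dec-false (v ≟ u) (u≢v ∘ sym)))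

maxDegree≡n∸1 : (G : Graph n) {Δ : ℕ} → IsMaxDegree G Δ → deg G u ≡ n ∸ 1 → Δ ≡ n ∸ 1
maxDegree≡n∸1 {u = u} G (bounded , v , dv) du =
  ≤-antisym (subst (_≤ _) dv (deg≤n∸1 G v)) (subst (_≤ _) du (bounded u))

deg-≅ : {G H : Graph n} ((σ , _) : G ≅ H) → ∀ i → deg G i ≡ deg H (σ ⟨$⟩ʳ i)
deg-≅ {H = H} (σ , preserves) i =
  trans (count-cong (preserves i)) (count-permute {p = adj H (σ ⟨$⟩ʳ i)} σ)

degSum : Graph n → ℕ
degSum {n} G = ∑[ k < n ] deg G k

degSum-≅ : {G H : Graph n} → G ≅ H → degSum G ≡ degSum H
degSum-≅ {G = G} {H = H} iso@(σ , _) =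
  trans (sum-cong-≗ (deg-≅ {G = G} {H = H} iso)) (sym (∑-permute (deg H) σ))

-- Degree sums

degSum-extend : (G : Graph n) {a b : Fin n} → a ≢ b → degSum (extend G a b) ≡ 4 + degSum G
degSum-extend {n} G {a} {b} a≢b = begin
  deg E zero + ∑[ k < n ] deg E (suc k)
    ≡⟨ cong₂ _+_ (trans (count-suc (adj E zero)) (count-spine a≢b))
                 (sum-cong-≗ (count-suc ∘ adj E ∘ suc)) ⟩
  2 + ∑[ k < n ] (indicator (spine a b k) + deg G k)
    ≡⟨ cong (2 +_) (∑-distrib-+ (indicator ∘ spine a b) (deg G)) ⟩
  2 + (∑[ k < n ] indicator (spine a b k) + degSum G)
    ≡⟨ cong (λ s → 2 + (s + degSum G)) (trans (sym (count-∑ (spine a b))) (count-spine a≢b)) ⟩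
  4 + degSum G ∎
  where
  open ≡-Reasoning
  E : Graph (suc n)
  E = extend G a b

degSum-built : {H : Graph n} → Built2Tree n H → degSum H + 6 ≡ 4 * n
degSum-built base = refl
degSum-built {suc n} (add {G = G} t a b ab) = begin
  degSum (extend G a b) + 6 ≡⟨ cong (_+ 6) (degSum-extend G (Adj⇒≢ G ab)) ⟩
  4 + (degSum G + 6)        ≡⟨ cong (4 +_) (degSum-built t) ⟩
  4 + 4 * n                 ≡⟨ *-suc 4 n ⟨
  4 * suc n                 ∎
  where open ≡-Reasoning

degSum-2tree : {G : Graph n} → Is2Tree G → degSum G + 6 ≡ 4 * n
degSum-2tree {G = G} (H , built , iso) =
  trans (cong (_+ 6) (degSum-≅ {G = G} {H} iso)) (degSum-built built)

isTail3 : (G : Graph n) (Δ : ℕ) → Fin n → Bool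
isTail3 G Δ v = if inCore G Δ v then false else does (deg G v ≟ℕ 3)

deg-split : {G : Graph n} {Δ : ℕ} → TailSet23 G Δ →
            ∀ v → deg G v ≡ (if inCore G Δ v then Δ else 2) + indicator (isTail3 G Δ v)
deg-split {G = G} {Δ} tail v with inCore G Δ v in core
... | true = trans (does-true (deg G v ≟ℕ Δ) core) (sym (+-identityʳ Δ))
... | false with tail v (does-false (deg G v ≟ℕ Δ) core)
...   | inj₁ d≡2 rewrite d≡2 = refl
...   | inj₂ d≡3 rewrite d≡3 = refl

degSum-central : {G : Graph n} {Δ r : ℕ} → IsCentral r G Δ → TailSet23 G Δ →
                 degSum G + r * 2 ≡ r * Δ + n * 2 + tailDeg3Count G Δ
degSum-central {n} {G} {Δ} {r} (_ , |core|≡r) tail = begin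
  degSum G + r * 2
    ≡⟨ cong (_+ r * 2) (sum-cong-≗ (deg-split {G = G} tail)) ⟩
  ∑[ k < n ] ((if core k then Δ else 2) + indicator (isTail3 G Δ k)) + r * 2
    ≡⟨ cong (_+ r * 2) (∑-distrib-+ (λ k → if core k then Δ else 2) (indicator ∘ isTail3 G Δ)) ⟩
  ∑[ k < n ] (if core k then Δ else 2) + ∑[ k < n ] indicator (isTail3 G Δ k) + r * 2
    ≡⟨ cong₂ (λ s t → s + t + r * 2) (∑-if core Δ 2) (sym (count-∑ (isTail3 G Δ))) ⟩
  count core * Δ + |tail| * 2 + x + r * 2
    ≡⟨ cong (λ c → c * Δ + |tail| * 2 + x + r * 2) |core|≡r ⟩
  r * Δ + |tail| * 2 + x + r * 2
    ≡⟨ regroup r Δ |tail| x ⟩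
  r * Δ + (r + |tail|) * 2 + x
    ≡⟨ cong (λ m → r * Δ + m * 2 + x)
            (trans (cong (_+ |tail|) (sym |core|≡r)) (count-complement core)) ⟩
  r * Δ + n * 2 + x ∎
  where
  open ≡-Reasoning
  core : Fin n → Bool
  core = inCore G Δ
  |tail| x : ℕ
  |tail| = count (not ∘ core)
  x = tailDeg3Count G Δ
  regroup : ∀ r Δ m x → r * Δ + m * 2 + x + r * 2 ≡ r * Δ + (r + m) * 2 + x
  regroup = solve-∀

degree-identity : {G : Graph n} {Δ : ℕ} → Is2Tree G → IsCentral 2 G Δ → TailSet23 G Δ →
                  2 * suc Δ + tailDeg3Count G Δ ≡ 2 * n
degree-identity {n} {G} {Δ} tree central tail = +-cancelʳ-≡ (n * 2) _ _ (begin
  2 * suc Δ + x + n * 2        ≡⟨ shuffle Δ n x ⟩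
  2 * Δ + n * 2 + x + 2        ≡⟨ cong (_+ 2) (degSum-central {G = G} central tail) ⟨
  degSum G + 4 + 2             ≡⟨ +-assoc (degSum G) 4 2 ⟩
  degSum G + 6                 ≡⟨ degSum-2tree {G = G} tree ⟩
  4 * n                        ≡⟨ double n ⟩
  2 * n + n * 2                ∎)
  where
  open ≡-Reasoning
  x : ℕ
  x = tailDeg3Count G Δ
  shuffle : ∀ Δ n x → 2 * suc Δ + x + n * 2 ≡ 2 * Δ + n * 2 + x + 2
  shuffle = solve-∀
  double : ∀ n → 4 * n ≡ 2 * n + n * 2
  double = solve-∀

x≡0⇔Δ≡m : ∀ {Δ x m} → 2 * suc Δ + x ≡ 2 * suc m → x ≡ 0 ⇔ Δ ≡ m
x≡0⇔Δ≡m {Δ} {x} {m} e = mk⇔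
  (λ { refl → suc-injective (*-cancelˡ-≡ (suc Δ) (suc m) 2 (trans (sym (+-identityʳ _)) e)) })
  (λ { refl → +-cancelˡ-≡ (2 * suc Δ) x 0 (trans e (sym (+-identityʳ _))) })

isTail3-intro : (G : Graph n) {Δ : ℕ} {w : Fin n} →
                deg G w ≢ Δ → deg G w ≡ 3 → isTail3 G Δ w ≡ true
isTail3-intro G {Δ} {w} d≢Δ d≡3 rewrite dec-false (deg G w ≟ℕ Δ) d≢Δ =
  dec-true (deg G w ≟ℕ 3) d≡3

tail3-free⇒deg≡2 : {G : Graph n} {Δ : ℕ} → TailSet23 G Δ → tailDeg3Count G Δ ≡ 0 →
                   ∀ w → deg G w ≢ Δ → deg G w ≡ 2
tail3-free⇒deg≡2 {G = G} tail x≡0 w d≢Δ with tail w d≢Δ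
... | inj₁ d≡2 = d≡2
... | inj₂ d≡3 with () ← trans (sym (count≡0⇒false x≡0 w)) (isTail3-intro G d≢Δ d≡3)

-- Books

bookOn : Fin n → Fin n → Fin n → Fin n → Bool
bookOn u v i j = if does (i ≟ j) then false else (spine u v i ∨ spine u v j)

record IsBookOn (G : Graph n) (u v : Fin n) : Set where
  constructor isBookOn
  field adj≡bookOn : ∀ i j → adj G i j ≡ bookOn u v i j

bookOn-spine : (u v i j : Fin n) → spine u v i ≡ true → bookOn u v i j ≡ others i j
bookOn-spine u v i j si rewrite si with i ≟ j | j ≟ i
... | yes _   | yes _   = refl
... | no _    | no _    = refl
... | yes i≡j | no j≢i  = ⊥-elim (j≢i (sym i≡j))
... | no i≢j  | yes j≡i = ⊥-elim (i≢j (sym j≡i))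

bookOn-page : (u v i j : Fin n) → spine u v i ≡ false → bookOn u v i j ≡ spine u v j
bookOn-page u v i j si rewrite si with i ≟ j
... | yes refl = sym si
... | no _     = refl

bookOn-adj : {G : Graph n} → IsBookOn G u v → spine u v i ≡ true → i ≢ j → Adj G i j
bookOn-adj {u = u} {v} {i} {j} (isBookOn book) si i≢j =
  trans (book i j) (trans (bookOn-spine u v i j si) (cong not (dec-false (j ≟ i) (i≢j ∘ sym))))

deg-bookOn-spine : {G : Graph n} → IsBookOn G u v → ∀ i → spine u v i ≡ true → deg G i ≡ n ∸ 1
deg-bookOn-spine {u = u} {v} (isBookOn book) i si =
  trans (count-cong (λ j → trans (book i j) (bookOn-spine u v i j si))) (count-others i)

deg-bookOn-page : {G : Graph n} → u ≢ v → IsBookOn G u v →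
                  ∀ i → spine u v i ≡ false → deg G i ≡ 2
deg-bookOn-page {u = u} {v} u≢v (isBookOn book) i si =
  trans (count-cong (λ j → trans (book i j) (bookOn-page u v i j si))) (count-spine u≢v)

deg-bookOn : {G : Graph n} → u ≢ v → IsBookOn G u v → ∀ i → deg G i ≡ n ∸ 1 ⊎ deg G i ≡ 2
deg-bookOn {u = u} {v} u≢v book i with spine u v i in si
... | true  = inj₁ (deg-bookOn-spine book i si)
... | false = inj₂ (deg-bookOn-page u≢v book i si)

isBookOn-from-degrees : (G : Graph n) → u ≢ v →
                        (∀ w → spine u v w ≡ true → deg G w ≡ n ∸ 1) →
                        (∀ w → spine u v w ≡ false → deg G w ≡ 2) →
                        IsBookOn G u v
isBookOn-from-degrees {u = u} {v} G u≢v full page = isBookOn λ i j → row i j (spine u v i) refl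
  where
  page-neighbours : ∀ i → spine u v i ≡ false → adj G i ≗ spine u v
  page-neighbours i si = ⊆-antisym
    (count-≤⇒⊇ spine⊆adj (≤-reflexive (trans (page i si) (sym (count-spine u≢v))))) spine⊆adj
    where
    spine⊆adj : spine u v ⊆ adj G i
    spine⊆adj w sw =
      Adj-sym G (trans (deg≡n∸1⇒adj≗others G (full w sw) i) (cong not (dec-false (i ≟ w) i≢w)))
      where
      i≢w : i ≢ w
      i≢w refl with () ← trans (sym si) sw
  row : ∀ i j b → spine u v i ≡ b → adj G i j ≡ bookOn u v i j
  row i j true  si = trans (deg≡n∸1⇒adj≗others G (full i si) j) (sym (bookOn-spine u v i j si))
  row i j false si = trans (page-neighbours i si j) (sym (bookOn-page u v i j si))

permute-injective : (σ : Permutation′ n) → σ ⟨$⟩ʳ i ≡ σ ⟨$⟩ʳ j → i ≡ j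
permute-injective σ e = trans (sym (inverseˡ σ)) (trans (cong (σ ⟨$⟩ˡ_) e) (inverseˡ σ))

does-≟-permute : (σ : Permutation′ n) (i j : Fin n) → does (σ ⟨$⟩ʳ i ≟ σ ⟨$⟩ʳ j) ≡ does (i ≟ j)
does-≟-permute σ i j =
  does-⇔ (mk⇔ (permute-injective σ) (cong (σ ⟨$⟩ʳ_))) (σ ⟨$⟩ʳ i ≟ σ ⟨$⟩ʳ j) (i ≟ j)

bookOn-permute : (σ : Permutation′ n) (u v i j : Fin n) →
                 bookOn (σ ⟨$⟩ʳ u) (σ ⟨$⟩ʳ v) (σ ⟨$⟩ʳ i) (σ ⟨$⟩ʳ j) ≡ bookOn u v i j
bookOn-permute σ u v i j =
  cong₂ (λ b s → if b then false else s)
        (does-≟-permute σ i j) (cong₂ _∨_ (spine-permute i) (spine-permute j))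
  where
  spine-permute : ∀ k → spine (σ ⟨$⟩ʳ u) (σ ⟨$⟩ʳ v) (σ ⟨$⟩ʳ k) ≡ spine u v k
  spine-permute k = cong₂ _∨_ (does-≟-permute σ k u) (does-≟-permute σ k v)

transpose-matchˡ : (i j : Fin n) → transpose i j ⟨$⟩ʳ i ≡ j
transpose-matchˡ i j rewrite dec-true (i ≟ i) refl = refl

transpose-other : (i j : Fin n) {k : Fin n} → k ≢ i → k ≢ j → transpose i j ⟨$⟩ʳ k ≡ k
transpose-other i j {k} k≢i k≢j rewrite dec-false (k ≟ i) k≢i | dec-false (k ≟ j) k≢j = refl

permutation-sending : {u v u′ v′ : Fin n} → u ≢ v → u′ ≢ v′ →
                      ∃[ σ ] σ ⟨$⟩ʳ u ≡ u′ × σ ⟨$⟩ʳ v ≡ v′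
permutation-sending {n} {u} {v} {u′} {v′} u≢v u′≢v′ =
  τ ∘ₚ transpose w v′ ,
  trans (cong (transpose w v′ ⟨$⟩ʳ_) (transpose-matchˡ u u′)) (transpose-other w v′ u′≢w u′≢v′) ,
  transpose-matchˡ w v′
  where
  τ : Permutation′ n
  τ = transpose u u′
  w : Fin n
  w = τ ⟨$⟩ʳ v
  u′≢w : u′ ≢ w
  u′≢w u′≡w = u≢v (permute-injective τ (trans (transpose-matchˡ u u′) u′≡w))

≅-bookOn : {G H : Graph n} {u v u′ v′ : Fin n} → u ≢ v → u′ ≢ v′ →
           IsBookOn G u v → IsBookOn H u′ v′ → G ≅ H
≅-bookOn {G = G} {H} {u} {v} {u′} {v′} u≢v u′≢v′ (isBookOn G-book) (isBookOn H-book)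
  with σ , σu , σv ← permutation-sending u≢v u′≢v′ = σ , λ i j → begin
    adj G i j                                           ≡⟨ G-book i j ⟩
    bookOn u v i j                                      ≡⟨ bookOn-permute σ u v i j ⟨
    bookOn (σ ⟨$⟩ʳ u) (σ ⟨$⟩ʳ v) (σ ⟨$⟩ʳ i) (σ ⟨$⟩ʳ j)
      ≡⟨ cong₂ (λ a b → bookOn a b (σ ⟨$⟩ʳ i) (σ ⟨$⟩ʳ j)) σu σv ⟩
    bookOn u′ v′ (σ ⟨$⟩ʳ i) (σ ⟨$⟩ʳ j)                  ≡⟨ H-book (σ ⟨$⟩ʳ i) (σ ⟨$⟩ʳ j) ⟨
    adj H (σ ⟨$⟩ʳ i) (σ ⟨$⟩ʳ j)                         ∎
  where open ≡-Reasoning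

Book-isBookOn : ∀ n → IsBookOn (Book (2 + n)) zero (suc zero)
Book-isBookOn n = isBookOn λ i j →
  cong₂ (λ a b → if does (i ≟ j) then false else (a ∨ b)) (below2 i) (below2 j)
  where
  below2 : (k : Fin (2 + n)) → does (toℕ k ℕ.<? 2) ≡ spine zero (suc zero) k
  below2 zero          = refl
  below2 (suc zero)    = refl
  below2 (suc (suc _)) = refl

Book-core : ∀ k → inCore (Book (4 + k)) (3 + k) ≗ spine zero (suc zero)
Book-core k v with spine zero (suc zero) v in sv
... | true  = dec-true (_ ≟ℕ _) (deg-bookOn-spine (Book-isBookOn (2 + k)) v sv)
... | false = dec-false (_ ≟ℕ _) (2≢3+k ∘ trans (sym (deg-bookOn-page (λ ()) (Book-isBookOn (2 + k)) v sv)))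
  where
  2≢3+k : 2 ≢ 3 + k
  2≢3+k ()

Book-strongBicentral : ∀ k → IsStrongBicentral (Book (4 + k)) (3 + k)
Book-strongBicentral k =
  ((deg≤n∸1 B , zero , deg-bookOn-spine (Book-isBookOn (2 + k)) zero refl) ,
   trans (count-cong (Book-core k)) (count-spine {u = zero {n = 3 + k}} {suc zero} λ ())) ,
  isStrong-n∸1 B
  where
  B : Graph (4 + k)
  B = Book (4 + k)

spineˡ spineʳ : ∀ m → Fin (3 + m)
spineˡ m = inject₁ (fromℕ (suc m))
spineʳ m = fromℕ (suc (suc m))

spineˡ≢spineʳ : ∀ m → spineˡ m ≢ spineʳ m
spineˡ≢spineʳ m = fromℕ≢inject₁ ∘ sym

-- extend numbers the new vertex 0 and shifts the old ones, so the spine {1, 2}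
-- of K₃ stays at the last two vertices.
bookTree : ∀ m → Graph (3 + m)
bookTree zero    = K3
bookTree (suc m) = extend (bookTree m) (spineˡ m) (spineʳ m)

bookTree-isBookOn : ∀ m → IsBookOn (bookTree m) (spineˡ m) (spineʳ m)
bookTree-isBookOn zero    = isBookOn (from-yes (all? λ i → all? λ j →
                              adj K3 i j Bool.≟ bookOn (spineˡ 0) (spineʳ 0) i j))
bookTree-isBookOn (suc m) = isBookOn extended
  where
  extended : ∀ i j → adj (bookTree (suc m)) i j ≡ bookOn (spineˡ (suc m)) (spineʳ (suc m)) i j
  extended zero    zero    = refl
  extended zero    (suc j) = refl
  extended (suc i) zero    = sym (∨-identityʳ _)
  extended (suc i) (suc j) = IsBookOn.adj≡bookOn (bookTree-isBookOn m) i j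

bookTree-built : ∀ m → Built2Tree (3 + m) (bookTree m)
bookTree-built zero    = base
bookTree-built (suc m) = add (bookTree-built m) (spineˡ m) (spineʳ m)
  (bookOn-adj (bookTree-isBookOn m) (spine-left (spineˡ m) (spineʳ m)) (spineˡ≢spineʳ m))

Book-is2Tree : ∀ m → Is2Tree (Book (3 + m))
Book-is2Tree m =
  bookTree m , bookTree-built m ,
  ≅-bookOn (λ ()) (spineˡ≢spineʳ m) (Book-isBookOn (suc m)) (bookTree-isBookOn m)

bicentral-≅-Book : ∀ {m} (G : Graph (2 + m)) {Δ : ℕ} → IsCentral 2 G Δ → Δ ≡ suc m →
                   (∀ w → deg G w ≢ Δ → deg G w ≡ 2) → G ≅ Book (2 + m)
bicentral-≅-Book {m} G {Δ} (_ , |core|≡2) refl tail2 = from-spine (count≡2⇒spine |core|≡2)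
  where
  from-spine : ∃[ u ] ∃[ v ] u ≢ v × inCore G Δ ≗ spine u v → G ≅ Book (2 + m)
  from-spine (u , v , u≢v , core≗spine) =
    ≅-bookOn u≢v (λ ()) (isBookOn-from-degrees G u≢v full page) (Book-isBookOn m)
    where
    full : ∀ w → spine u v w ≡ true → deg G w ≡ suc m
    full w sw = does-true (deg G w ≟ℕ Δ) (trans (core≗spine w) sw)
    page : ∀ w → spine u v w ≡ false → deg G w ≡ 2
    page w sw = tail2 w (does-false (deg G w ≟ℕ Δ) (trans (core≗spine w) sw))

≅-Book⇒Δ≡n∸1 : ∀ {m} (G : Graph (2 + m)) {Δ : ℕ} →
               IsMaxDegree G Δ → G ≅ Book (2 + m) → Δ ≡ suc m
≅-Book⇒Δ≡n∸1 {m} G maxDeg iso@(σ , _) = maxDegree≡n∸1 G maxDeg (begin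
  deg G (σ ⟨$⟩ˡ zero)              ≡⟨ deg-≅ {G = G} {B} iso (σ ⟨$⟩ˡ zero) ⟩
  deg B (σ ⟨$⟩ʳ (σ ⟨$⟩ˡ zero))     ≡⟨ cong (deg B) (inverseʳ σ) ⟩
  deg B zero                       ≡⟨ deg-bookOn-spine (Book-isBookOn m) zero refl ⟩
  suc m                            ∎)
  where
  open ≡-Reasoning
  B : Graph (2 + m)
  B = Book (2 + m)

characterisation : ∀ (n : ℕ) → 4 ≤ n → (G : Graph n) → (Δ : ℕ) →
  Is2Tree G → IsStrongBicentral G Δ → TailSet23 G Δ →
  ((tailDeg3Count G Δ ≡ 0) ⇔ (Δ ≡ n ∸ 1)) × ((Δ ≡ n ∸ 1) ⇔ (G ≅ Book n))
characterisation _ (s≤s (s≤s {n = m} _)) G Δ tree (central , _) tail =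
  tail3-free⇔Δ≡n∸1 ,
  mk⇔ (λ Δ≡n∸1 → bicentral-≅-Book G central Δ≡n∸1
                    (tail3-free⇒deg≡2 {G = G} tail (Equivalence.from tail3-free⇔Δ≡n∸1 Δ≡n∸1)))
      (≅-Book⇒Δ≡n∸1 G (proj₁ central))
  where
  tail3-free⇔Δ≡n∸1 : tailDeg3Count G Δ ≡ 0 ⇔ Δ ≡ suc m
  tail3-free⇔Δ≡n∸1 = x≡0⇔Δ≡m (degree-identity {G = G} tree central tail)

book-unique : ∀ (n : ℕ) → 4 ≤ n → (G : Graph n) → Is2Tree G → IsStrongBicentral G (n ∸ 1) →
              (∀ v → deg G v ≡ n ∸ 1 ⊎ deg G v ≡ 2) → G ≅ Book n
book-unique n 4≤n G tree sb degrees =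
  Equivalence.to (proj₂ (characterisation n 4≤n G (n ∸ 1) tree sb tail23)) refl
  where
  tail23 : TailSet23 G (n ∸ 1)
  tail23 v d≢n∸1 with degrees v
  ... | inj₁ d≡n∸1 = ⊥-elim (d≢n∸1 d≡n∸1)
  ... | inj₂ d≡2   = inj₁ d≡2

book-properties : ∀ (n : ℕ) → 4 ≤ n →
  Is2Tree (Book n) × IsStrongBicentral (Book n) (n ∸ 1)
    × (∀ v → deg (Book n) v ≡ n ∸ 1 ⊎ deg (Book n) v ≡ 2)
book-properties _ (s≤s (s≤s (s≤s (s≤s {n = k} _)))) =
  Book-is2Tree (suc k) , Book-strongBicentral k , deg-bookOn (λ ()) (Book-isBookOn (2 + k))

theorem4p3 :
    (∀ (n : ℕ) → 4 ≤ n → (G : Graph n) → (Δ : ℕ) →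
      Is2Tree G → IsStrongBicentral G Δ → TailSet23 G Δ →
      ((tailDeg3Count G Δ ≡ 0) ⇔ (Δ ≡ n ∸ 1))
      × ((Δ ≡ n ∸ 1) ⇔ (G ≅ Book n)))
    ×
    (∀ (n : ℕ) → 4 ≤ n →
      (Is2Tree (Book n) × IsStrongBicentral (Book n) (n ∸ 1)
        × (∀ v → deg (Book n) v ≡ n ∸ 1 ⊎ deg (Book n) v ≡ 2))
      × (∀ (G : Graph n) → Is2Tree G → IsStrongBicentral G (n ∸ 1)
           → (∀ v → deg G v ≡ n ∸ 1 ⊎ deg G v ≡ 2) → G ≅ Book n))
theorem4p3 = characterisation , λ n 4≤n → book-properties n 4≤n , book-unique n 4≤n
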